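{- Let $n\geqslant 2$ and $c\geqslant 1$ be integers and let $\Gamma$ be an abelian group of order $2nc$. A diagonal $\mathrm{MRS}_\Gamma(n;2;c)$ exists if and only if $\Gamma$ contains an element of order $n$.
   Context: For positive integers $m,n,s,k,c$ and an abelian group $\Gamma$ of order $nkc$, an $\mathrm{MRS}_\Gamma(m,n;s,k;c)$ is a set of $c$ partially filled $m\times n$ arrays (some cells may be empty) with entries in $\Gamma$ such that every element of $\Gamma$ appears exactly once and in a unique array; in every array each row has exactly $s$ filled cells and each column exactly $k$ filled cells; and there exist $\omega,\delta\in\Gamma$ such that in every array each row sums to $\omega$ and each column sums to $\delta$. $\mathrm{MRS}_\Gamma(n;k;c)$ denotes $\mathrm{MRS}_\Gamma(n,n;k,k;c)$. For an $n\times n$ array, the diagonal $D_\ell$ ($0\leqslant\ell\leqslant n-1$) is the set of cells $(i,j)$ with $j-i\equiv\ell\pmod n$. An $\mathrm{MRS}_\Gamma(n;k;c)$ is diagonal if, in every one of its arrays, the filled cells are exactly the cells of $k$ consecutive diagonals $D_t,D_{t+1},\ldots,D_{t+k-1}$ (indices modulo $n$). -}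

module Defs where

open import Level using (Level; _⊔_)
open import Algebra.Bundles using (AbelianGroup)
open import Data.Nat using (ℕ; zero; suc; _+_; _*_; _≤_; _<_)
open import Data.Fin using (Fin; toℕ)
open import Data.List using (List; []; _∷_; map; sum; allFin)
open import Data.Maybe using (Maybe; just; nothing)
open import Data.Product using (Σ; ∃; _×_; _,_)
open import Relation.Binary.PropositionalEquality using (_≡_)
open import Relation.Nullary using (¬_)
open import Function.Bundles using (_⇔_)

module _ {a ℓ : Level} (G : AbelianGroup a ℓ) where
  open AbelianGroup G renaming (Carrier to Γ)

  -- a partially filled m × n array with entries in Γ (nothing = empty cell)
  Array : ℕ → ℕ → Set a
  Array m n = Fin m → Fin n → Maybe Γ

  mul : ℕ → Γ → Γ
  mul zero g = ε
  mul (suc k) g = g ∙ mul k g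

  HasCardinality : ℕ → Set (a ⊔ ℓ)
  HasCardinality N =
    Σ (Fin N → Γ) λ f →
      (∀ i j → f i ≈ f j → i ≡ j) × (∀ g → ∃ λ i → f i ≈ g)

  HasOrder : Γ → ℕ → Set ℓ
  HasOrder g n =
    1 ≤ n × mul n g ≈ ε × (∀ m → 1 ≤ m → m < n → ¬ (mul m g ≈ ε))

  filledCount : List (Maybe Γ) → ℕ
  filledCount [] = 0
  filledCount (just _ ∷ xs) = suc (filledCount xs)
  filledCount (nothing ∷ xs) = filledCount xs

  filledSum : List (Maybe Γ) → Γ
  filledSum [] = ε
  filledSum (just x ∷ xs) = x ∙ filledSum xs
  filledSum (nothing ∷ xs) = filledSum xs

  row : ∀ {m n} → Array m n → Fin m → List (Maybe Γ)
  row {n = n} A i = map (λ j → A i j) (allFin n)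

  col : ∀ {m n} → Array m n → Fin n → List (Maybe Γ)
  col {m = m} A j = map (λ i → A i j) (allFin m)

  Filled : Maybe Γ → Set a
  Filled x = ∃ λ g → x ≡ just g

  Contains : ∀ {m n c} → (Fin c → Array m n) → Fin c × Fin m × Fin n → Γ → Set (a ⊔ ℓ)
  Contains A (x , i , j) g = ∃ λ h → A x i j ≡ just h × h ≈ g

  record IsMRS (m n s k c : ℕ) (A : Fin c → Array m n) : Set (a ⊔ ℓ) where
    field
      order       : HasCardinality (n * k * c)
      exactlyOnce : ∀ g → Σ (Fin c × Fin m × Fin n) λ p →
                      Contains A p g × (∀ p′ → Contains A p′ g → p′ ≡ p)
      rowFilled   : ∀ x i → filledCount (row (A x) i) ≡ s
      colFilled   : ∀ x j → filledCount (col (A x) j) ≡ k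
      magicSums   : Σ Γ λ ω → Σ Γ λ δ →
                      (∀ x i → filledSum (row (A x) i) ≈ ω) ×
                      (∀ x j → filledSum (col (A x) j) ≈ δ)

  -- cell (i,j) lies in one of the diagonals D_t, …, D_{t+k-1} (indices mod n),
  -- i.e. j - i ≡ t + r (mod n) for some r < k; as i,t,r,j are naturals with j < n
  -- this is:  i + t + r = j + q n  for some q.
  InDiagonals : ∀ {n} → ℕ → Fin n → Fin n → Fin n → Set
  InDiagonals {n} k t i j =
    ∃ λ r → r < k × ∃ λ q → toℕ i + toℕ t + r ≡ toℕ j + q * n

  IsDiagonal : ∀ {n c} → ℕ → (Fin c → Array n n) → Set a
  IsDiagonal {n} k A =
    ∀ x → ∃ λ (t : Fin n) → ∀ i j → Filled (A x i j) ⇔ InDiagonals k t i j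

  DiagonalMRSExists : ℕ → ℕ → ℕ → Set (a ⊔ ℓ)
  DiagonalMRSExists n k c =
    Σ (Fin c → Array n n) λ A → IsMRS n n k k c A × IsDiagonal k A

{-# OPTIONS --safe #-}
module Submission where

-- Write Γ additively. In an array whose filled cells are the diagonals D_t and D_{t+1}, row a holds
-- α_a on D_t and β_a on D_{t+1}, and the column through β_a also holds α_{a+1}. The row and column
-- sums give α_{a+1} = α_a + (δ − ω), so α_a = α_0 + a (δ − ω); as α_n = α_0 while α_0, …, α_{n−1}
-- are distinct entries of Γ, the element δ − ω has order n.
--
-- Conversely, let d have order n and H = ⟨d⟩, so that Γ/H has order 2c. Pairing each coset with its
-- negative shows that Γ/H has an element of order 2, hence doubling on Γ/H is not onto: there is ω
-- with ω ∉ 2y + H for every y. Then y + H ≠ (ω − y) + H, and Γ splits into c blocks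
-- (y + H) ∪ ((ω − y) + H) of size 2n. The block of y gives the array with y + i d in cell (i, i) and
-- ω − y − i d in cell (i, i + 1), whose rows sum to ω and whose columns sum to ω + d.

open import Defs
open import Level using (Level; _⊔_)
open import Algebra.Bundles using (AbelianGroup)
open import Data.Nat using (ℕ; zero; suc; NonZero; _∸_; _+_; _*_; _≤_; _<_; z≤n; s≤s)
open import Data.Nat.Properties
  using ( +-comm; +-assoc; +-suc; +-identityʳ; *-comm; *-suc; *-cancelˡ-≡; *-cancelʳ-≡; +-commutativeSemigroup
        ; ≤-trans; ≤-reflexive; ≤-antisym; <-≤-trans; ≤-<-trans; <⇒≤; <⇒≱; <-cmp; n<1+n; 1+n≰n; m≤m*n; m≤n+m
        ; m∸n≤m; m<n⇒0<n∸m; m+[n∸m]≡n; 0≢1+n; even≢odd )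
open import Data.Nat.Solver using (module +-*-Solver)
open import Data.Nat.DivMod
  using ( _%_; _/_; _mod_; %-distribˡ-+; [m+kn]%n≡m%n; [m+n]%n≡m%n; m%n%n≡m%n; m<n⇒m%n≡m; m≡m%n+[m/n]*n
        ; n%n≡0 )
open import Data.Fin using (Fin; toℕ; zero; suc; splitAt; join; _↑ˡ_; _↑ʳ_; punchOut)
open import Data.List using (List; map; tabulate; allFin)
import Data.List.Properties as List
open import Data.Maybe using (Maybe; just; nothing)
open import Data.Maybe.Properties using (just-injective)
open import Data.Empty using (⊥-elim)
open import Data.Vec.Functional using (_∷_)
import Data.Fin.Properties as Fin
open import Data.Product using (Σ; ∃; _×_; _,_; proj₁; proj₂)
open import Data.Sum using (_⊎_; inj₁; inj₂; [_,_])
open import Data.Sum.Properties using (inj₂-injective)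
open import Relation.Nullary using (¬_; ¬?; Dec; yes; no; _×-dec_)
open import Relation.Nullary.Decidable using (decidable-stable)
open import Relation.Binary.Bundles using (Setoid)
open import Relation.Binary.Definitions using (tri<; tri≈; tri>)
open import Relation.Binary.PropositionalEquality as ≡ using (_≡_; _≢_; refl; cong; cong₂; subst)
open import Function.Base using (id; _∘_)
open import Function.Bundles using (_⇔_; mk⇔; Equivalence; _↔_; Inverse)
open import Function.Construct.Composition using (_↔-∘_)
open import Function.Construct.Identity using (↔-id)
open import Data.Sum.Function.Propositional using (_⊎-↔_)

module Residues (k : ℕ) where

  n : ℕ
  n = 2 + k

  infix 4 _≋_
  _≋_ : ℕ → ℕ → Set
  a ≋ b = a % n ≡ b % n

  ≡⇒≋ : ∀ {a b} → a ≡ b → a ≋ b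
  ≡⇒≋ = cong (_% n)

  +-cong-≋ : ∀ {a b c d} → a ≋ b → c ≋ d → a + c ≋ b + d
  +-cong-≋ {a} {b} {c} {d} a≋b c≋d = begin
    (a + c) % n          ≡⟨ %-distribˡ-+ a c n ⟩
    (a % n + c % n) % n  ≡⟨ cong₂ (λ x y → (x + y) % n) a≋b c≋d ⟩
    (b % n + d % n) % n  ≡⟨ %-distribˡ-+ b d n ⟨
    (b + d) % n          ∎
    where open ≡.≡-Reasoning

  m+qn≋m : ∀ a q → a + q * n ≋ a
  m+qn≋m a q = [m+kn]%n≡m%n a q n

  -- a + t n = (a + t) + (n − 1) t
  +-cancelʳ-≋ : ∀ a b t → a + t ≋ b + t → a ≋ b
  +-cancelʳ-≋ a b t a+t≋b+t = begin
    a % n                      ≡⟨ m+qn≋m a t ⟨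
    (a + t * n) % n            ≡⟨ cong (_% n) (shift a) ⟩
    (a + t + (1 + k) * t) % n  ≡⟨ +-cong-≋ {a + t} {b + t} {(1 + k) * t} a+t≋b+t refl ⟩
    (b + t + (1 + k) * t) % n  ≡⟨ cong (_% n) (shift b) ⟨
    (b + t * n) % n            ≡⟨ m+qn≋m b t ⟩
    b % n                      ∎
    where
    open ≡.≡-Reasoning
    shift : ∀ x → x + t * n ≡ x + t + (1 + k) * t
    shift x = ≡.trans (cong (x +_) (*-comm t n)) (≡.sym (+-assoc x t _))

  +-cancelˡ-≋ : ∀ t a b → t + a ≋ t + b → a ≋ b
  +-cancelˡ-≋ t a b t+a≋t+b =
    +-cancelʳ-≋ a b t (≡.trans (≡⇒≋ (+-comm a t)) (≡.trans t+a≋t+b (≡⇒≋ (+-comm t b))))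

  m≉1+m : ∀ m → ¬ (m ≋ 1 + m)
  m≉1+m m m≋1+m = 0≢1+n (≡.trans (≡.sym (m<n⇒m%n≡m {n = n} (s≤s z≤n)))
    (≡.trans (+-cancelʳ-≋ 0 1 m m≋1+m) (m<n⇒m%n≡m {n = n} (s≤s (s≤s z≤n)))))

  toℕ-mod : ∀ a → toℕ (a mod n) ≡ a % n
  toℕ-mod a = Fin.toℕ-fromℕ< _

  mod-≋ : ∀ a → toℕ (a mod n) ≋ a
  mod-≋ a = ≡.trans (cong (_% n) (toℕ-mod a)) (m%n%n≡m%n a n)

  toℕ-≋-injective : ∀ (i j : Fin n) → toℕ i ≋ toℕ j → i ≡ j
  toℕ-≋-injective i j i≋j = Fin.toℕ-injective
    (≡.trans (≡.sym (m<n⇒m%n≡m (Fin.toℕ<n i))) (≡.trans i≋j (m<n⇒m%n≡m (Fin.toℕ<n j))))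

  ≋⇒≡-mod : ∀ (i : Fin n) a → toℕ i ≋ a → i ≡ a mod n
  ≋⇒≡-mod i a i≋a = toℕ-≋-injective _ _ (≡.trans i≋a (≡.sym (mod-≋ a)))

  mod-cong : ∀ a b → a ≋ b → a mod n ≡ b mod n
  mod-cong a b a≋b = ≋⇒≡-mod (a mod n) b (≡.trans (mod-≋ a) a≋b)

  ≡+qn⇒≋ : ∀ u j q → u ≡ j + q * n → j ≋ u
  ≡+qn⇒≋ u j q u≡j+qn = ≡.sym (≡.trans (≡⇒≋ u≡j+qn) (m+qn≋m j q))

  ≋⇒≡+qn : ∀ u (j : Fin n) → toℕ j ≋ u → ∃ λ q → u ≡ toℕ j + q * n
  ≋⇒≡+qn u j j≋u = u / n , ≡.trans (m≡m%n+[m/n]*n u n)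
    (cong (_+ (u / n) * n) (≡.trans (≡.sym j≋u) (m<n⇒m%n≡m (Fin.toℕ<n j))))

  mod≢mod-suc : ∀ a → a mod n ≢ (1 + a) mod n
  mod≢mod-suc a eq = m≉1+m a (≡.trans (≡.sym (mod-≋ a)) (≡.trans (cong (λ i → toℕ i % n) eq) (mod-≋ (1 + a))))

  next : Fin n → Fin n
  next i = (1 + toℕ i) mod n

  prev : Fin n → Fin n
  prev i = (toℕ i + (1 + k)) mod n

  ≢next : ∀ i → i ≢ next i
  ≢next i eq = mod≢mod-suc (toℕ i) (≡.trans (≡.sym (≋⇒≡-mod i (toℕ i) refl)) eq)

  next-prev : ∀ i → next (prev i) ≡ i
  next-prev i = toℕ-≋-injective _ i (begin
    toℕ (next (prev i)) % n     ≡⟨ mod-≋ (1 + toℕ (prev i)) ⟩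
    (1 + toℕ (prev i)) % n      ≡⟨ +-cong-≋ {1} {1} {toℕ (prev i)} {toℕ i + (1 + k)} refl (mod-≋ (toℕ i + (1 + k))) ⟩
    (1 + (toℕ i + (1 + k))) % n   ≡⟨ cong (_% n) (+-suc (toℕ i) (1 + k)) ⟨
    (toℕ i + n) % n             ≡⟨ [m+n]%n≡m%n (toℕ i) n ⟩
    toℕ i % n                   ∎)
    where open ≡.≡-Reasoning

  next-injective : ∀ i j → next i ≡ next j → i ≡ j
  next-injective i j eq = toℕ-≋-injective i j (+-cancelˡ-≋ 1 (toℕ i) (toℕ j)
    (≡.trans (≡.sym (mod-≋ (1 + toℕ i))) (≡.trans (cong (λ x → toℕ x % n) eq) (mod-≋ (1 + toℕ j)))))

2nc≢n+m[n+n] : ∀ n c m .{{_ : NonZero n}} → 2 * n * c ≢ n + m * (n + n)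
2nc≢n+m[n+n] n c m eq = even≢odd c m (*-cancelˡ-≡ (2 * c) (1 + 2 * m) n (begin
  n * (2 * c)        ≡⟨ solve 2 (λ n c → n :* (con 2 :* c) := con 2 :* n :* c) refl n c ⟩
  2 * n * c          ≡⟨ eq ⟩
  n + m * (n + n)    ≡⟨ solve 2 (λ n m → n :+ m :* (n :+ n) := n :* (con 1 :+ con 2 :* m)) refl n m ⟩
  n * (1 + 2 * m)    ∎))
  where open ≡.≡-Reasoning
        open +-*-Solver

surjective⇒injective : ∀ {m} (f : Fin m → Fin m) → (∀ y → ∃ λ x → f x ≡ y) → ∀ {a b} → f a ≡ f b → a ≡ b
surjective⇒injective {suc m} f onto {a} {b} fa≡fb = decidable-stable (a Fin.≟ b) collision-free
  where
  -- a section of f that avoids a injects Fin m into Fin (m − 1)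
  collision-free : ¬ a ≢ b
  collision-free a≢b = 1+n≰n (Fin.injective⇒≤ {f = shrink} shrink-injective)
    where
    section : Fin (suc m) → Fin (suc m)
    section y with proj₁ (onto y) Fin.≟ a
    ... | yes _ = b
    ... | no _ = proj₁ (onto y)

    f-section : ∀ y → f (section y) ≡ y
    f-section y with proj₁ (onto y) Fin.≟ a
    ... | yes hit = ≡.trans (≡.sym fa≡fb) (≡.trans (cong f (≡.sym hit)) (proj₂ (onto y)))
    ... | no _ = proj₂ (onto y)

    avoids-a : ∀ y → a ≢ section y
    avoids-a y with proj₁ (onto y) Fin.≟ a
    ... | yes _ = a≢b
    ... | no miss = miss ∘ ≡.sym

    shrink : Fin (suc m) → Fin m
    shrink y = punchOut (avoids-a y)

    shrink-injective : ∀ {x y} → shrink x ≡ shrink y → x ≡ y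
    shrink-injective {x} {y} eq = ≡.trans (≡.sym (f-section x))
      (≡.trans (cong f (Fin.punchOut-injective (avoids-a x) (avoids-a y) eq)) (f-section y))

module FiniteSetoid {a ℓ : Level} (S : Setoid a ℓ) (N : ℕ) (enum : Fin N → Setoid.Carrier S)
    (enum-injective : ∀ i j → Setoid._≈_ S (enum i) (enum j) → i ≡ j)
    (enum-surjective : ∀ g → ∃ λ i → Setoid._≈_ S (enum i) g) where
  open Setoid S hiding (refl) renaming (Carrier to A; sym to ≈-sym; trans to ≈-trans; reflexive to ≈-reflexive)

  index : A → Fin N
  index g = proj₁ (enum-surjective g)

  enum-index : ∀ g → enum (index g) ≈ g
  enum-index g = proj₂ (enum-surjective g)

  _≈?_ : ∀ x y → Dec (x ≈ y)
  x ≈? y with index x Fin.≟ index y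
  ... | yes eq = yes (≈-trans (≈-sym (enum-index x)) (≈-trans (≈-reflexive (cong enum eq)) (enum-index y)))
  ... | no neq = no λ x≈y → neq (enum-injective _ _ (≈-trans (enum-index x) (≈-trans x≈y (≈-sym (enum-index y)))))

  injection⇒≤ : ∀ {M} (h : Fin M → A) → (∀ i j → h i ≈ h j → i ≡ j) → M ≤ N
  injection⇒≤ h h-injective = Fin.injective⇒≤ {f = index ∘ h} λ {i} {j} eq →
    h-injective i j (≈-trans (≈-sym (enum-index (h i))) (≈-trans (≈-reflexive (cong enum eq)) (enum-index (h j))))

  surjection⇒≥ : ∀ {M} (h : Fin M → A) → (∀ g → ∃ λ i → h i ≈ g) → N ≤ M
  surjection⇒≥ h h-surjective = Fin.injective⇒≤ {f = λ i → proj₁ (h-surjective (enum i))} λ {i} {j} eq →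
    enum-injective i j (≈-trans (≈-sym (proj₂ (h-surjective (enum i))))
      (≈-trans (≈-reflexive (cong h eq)) (proj₂ (h-surjective (enum j)))))

  surjective? : ∀ {M} (h : Fin M → A) → (∀ g → ∃ λ i → h i ≈ g) ⊎ (∃ λ g → ∀ i → ¬ h i ≈ g)
  surjective? h with Fin.all? (λ j → Fin.any? (λ i → h i ≈? enum j))
  ... | yes hits = inj₁ λ g → let i , hi≈ = hits (index g) in i , ≈-trans hi≈ (enum-index g)
  ... | no ¬hits =
    let j , miss = Fin.¬∀⟶∃¬ N _ (λ j → Fin.any? (λ i → h i ≈? enum j)) ¬hits in
    inj₂ (enum j , λ i hi≈ → miss (i , hi≈))

  module Partition {n₀ b : ℕ} .{{_ : NonZero b}} (core : Fin n₀ → A) (block : A → Fin b → A)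
      (core-injective : ∀ i j → core i ≈ core j → i ≡ j)
      (block-injective : ∀ y → (∀ j → ¬ core j ≈ y) → ∀ l l′ → block y l ≈ block y l′ → l ≡ l′)
      (block-self : ∀ y → ∃ λ l → block y l ≈ y)
      (block-overlap : ∀ y z l l′ → block y l ≈ block z l′ → ∀ i → ∃ λ j → block y i ≈ block z j)
      (core-overlap : ∀ y l j → block y l ≈ core j → ∀ i → ∃ λ j′ → block y i ≈ core j′) where

    Point : ℕ → Set
    Point m = Fin n₀ ⊎ (Fin m × Fin b)

    point : ∀ {m} → (Fin m → A) → Point m → A
    point r (inj₁ j) = core j
    point r (inj₂ (x , l)) = block (r x) l

    PointInjective : ∀ {m} → (Fin m → A) → Set ℓ
    PointInjective r = ∀ p q → point r p ≈ point r q → p ≡ q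

    points↔ : ∀ {m} → Fin (n₀ + m * b) ↔ Point m
    points↔ = (↔-id _ ⊎-↔ Fin.*↔×) ↔-∘ Fin.+↔⊎

    module _ {m : ℕ} where
      open Inverse (points↔ {m}) public using () renaming (to to decode; from to encode)
      open Inverse (points↔ {m}) using (strictlyInverseˡ; strictlyInverseʳ)

      decode-injective : ∀ i j → decode i ≡ decode j → i ≡ j
      decode-injective i j eq =
        ≡.trans (≡.sym (strictlyInverseʳ i)) (≡.trans (cong encode eq) (strictlyInverseʳ j))

      point-decode-injective : (r : Fin m → A) → PointInjective r →
                               ∀ i j → point r (decode i) ≈ point r (decode j) → i ≡ j
      point-decode-injective r r-injective i j eq = decode-injective i j (r-injective _ _ eq)

      decode-encode : ∀ p → decode (encode p) ≡ p
      decode-encode = strictlyInverseˡ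

    module _ {m} (r : Fin m → A) (r-injective : PointInjective r) (g : A) (fresh : ∀ p → ¬ point r p ≈ g) where
      private
        l₀ = proj₁ (block-self g)
        l₀-self = proj₂ (block-self g)

      new∉core : ∀ l j → ¬ block g l ≈ core j
      new∉core l j eq = let j′ , eq′ = core-overlap g l j eq l₀ in
        fresh (inj₁ j′) (≈-trans (≈-sym eq′) l₀-self)

      new∉old : ∀ l x l′ → ¬ block g l ≈ block (r x) l′
      new∉old l x l′ eq = let l″ , eq′ = block-overlap g (r x) l l′ eq l₀ in
        fresh (inj₂ (x , l″)) (≈-trans (≈-sym eq′) l₀-self)

      ∷-pointInjective : PointInjective (g ∷ r)
      ∷-pointInjective (inj₁ j) (inj₁ j′) eq = cong inj₁ (core-injective j j′ eq)
      ∷-pointInjective (inj₁ j) (inj₂ (zero , l)) eq = ⊥-elim (new∉core l j (≈-sym eq))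
      ∷-pointInjective (inj₁ j) (inj₂ (suc x , l)) eq with () ← r-injective (inj₁ j) (inj₂ (x , l)) eq
      ∷-pointInjective (inj₂ (zero , l)) (inj₁ j) eq = ⊥-elim (new∉core l j eq)
      ∷-pointInjective (inj₂ (suc x , l)) (inj₁ j) eq with () ← r-injective (inj₂ (x , l)) (inj₁ j) eq
      ∷-pointInjective (inj₂ (zero , l)) (inj₂ (zero , l′)) eq =
        cong (λ l → inj₂ (zero , l)) (block-injective g (λ j → fresh (inj₁ j)) l l′ eq)
      ∷-pointInjective (inj₂ (zero , l)) (inj₂ (suc x , l′)) eq = ⊥-elim (new∉old l x l′ eq)
      ∷-pointInjective (inj₂ (suc x , l)) (inj₂ (zero , l′)) eq = ⊥-elim (new∉old l′ x l (≈-sym eq))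
      ∷-pointInjective (inj₂ (suc x , l)) (inj₂ (suc x′ , l′)) eq
        with refl ← r-injective (inj₂ (x , l)) (inj₂ (x′ , l′)) eq = refl

    record Decomposition : Set (a ⊔ ℓ) where
      field
        blocks     : ℕ
        rep        : Fin blocks → A
        size       : N ≡ n₀ + blocks * b
        injective  : PointInjective rep
        surjective : ∀ g → ∃ λ p → point rep p ≈ g

    -- Each round either covers A or adds a fresh block of b ≥ 1 elements, so N + 1 rounds suffice.
    grow : ∀ fuel {m} → N < n₀ + (m + fuel) * b → (r : Fin m → A) → PointInjective r → Decomposition
    grow fuel {m} bound r r-injective with surjective? (point r ∘ decode)
    ... | inj₁ onto = record
      { blocks = m ; rep = r ; injective = r-injective
      ; size = ≤-antisym (surjection⇒≥ _ onto) (injection⇒≤ _ (point-decode-injective r r-injective))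
      ; surjective = λ g → let i , eq = onto g in decode i , eq
      }
    grow zero {m} bound r r-injective | inj₂ _ =
      ⊥-elim (<⇒≱ (subst (λ z → N < n₀ + z * b) (+-identityʳ m) bound)
                  (injection⇒≤ _ (point-decode-injective r r-injective)))
    grow (suc fuel) {m} bound r r-injective | inj₂ (g , missed) =
      grow fuel (subst (λ z → N < n₀ + z * b) (+-suc m fuel) bound) (g ∷ r)
        (∷-pointInjective r r-injective g λ p eq →
          missed (encode p) (≈-trans (≈-reflexive (cong (point r) (decode-encode p))) eq))

    -- Opaque, since unfolding this search during conversion checking is prohibitively expensive.
    opaque
      decomposition : Decomposition
      decomposition = grow (suc N) {0} bound (λ ()) core-only
        where
        bound : N < n₀ + suc N * b
        bound = <-≤-trans (<-≤-trans (n<1+n N) (m≤m*n (suc N) b)) (m≤n+m _ n₀)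
        core-only : PointInjective {0} (λ ())
        core-only (inj₁ j) (inj₁ j′) eq = cong inj₁ (core-injective j j′ eq)

module Multiples {a ℓ : Level} (G : AbelianGroup a ℓ) where
  open AbelianGroup G using (_∙_; monoid)
  open import Algebra.Properties.Monoid.Mult monoid public using () renaming (_×_ to _·_)

  mul≡· : ∀ m g → mul G m g ≡ m · g
  mul≡· zero g = refl
  mul≡· (suc m) g = cong (g ∙_) (mul≡· m g)

module Cyclic {a ℓ : Level} (G : AbelianGroup a ℓ) (k : ℕ) (d : AbelianGroup.Carrier G)
    (d-order : HasOrder G d (2 + k)) where
  open AbelianGroup G renaming (Carrier to Γ; refl to ≈-refl; sym to ≈-sym; trans to ≈-trans; reflexive to ≈-reflexive)
  open import Algebra.Properties.Monoid.Mult monoid using (×-homo-+; ×-assocˡ; ×-congʳ)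
  open import Algebra.Properties.Group group using (∙-cancelˡ; ⁻¹-injective; inverseʳ-unique; ⁻¹-involutive)
  open import Algebra.Properties.AbelianGroup G using (⁻¹-∙-comm)
  open import Algebra.Properties.CommutativeSemigroup commutativeSemigroup using (interchange)
  open import Relation.Binary.Reasoning.Setoid setoid
  open Multiples G
  open Residues k

  n·d≈ε : n · d ≈ ε
  n·d≈ε = ≈-trans (≈-reflexive (≡.sym (mul≡· n d))) (proj₁ (proj₂ d-order))

  ·d≉ε : ∀ m → 1 ≤ m → m < n → ¬ m · d ≈ ε
  ·d≉ε m 1≤m m<n m·d≈ε = proj₂ (proj₂ d-order) m 1≤m m<n (≈-trans (≈-reflexive (mul≡· m d)) m·d≈ε)

  ·-ε : ∀ m → m · ε ≈ ε
  ·-ε zero = ≈-refl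
  ·-ε (suc m) = ≈-trans (identityˡ _) (·-ε m)

  qn·d≈ε : ∀ q → (q * n) · d ≈ ε
  qn·d≈ε q = begin
    (q * n) · d  ≈⟨ ×-assocˡ d q n ⟨
    q · (n · d)  ≈⟨ ×-congʳ q n·d≈ε ⟩
    q · ε        ≈⟨ ·-ε q ⟩
    ε            ∎

  ·d≈%n·d : ∀ m → m · d ≈ (m % n) · d
  ·d≈%n·d m = begin
    m · d                                ≈⟨ ≈-reflexive (cong (_· d) (m≡m%n+[m/n]*n m n)) ⟩
    (m % n + (m / n) * n) · d            ≈⟨ ×-homo-+ d (m % n) _ ⟩
    (m % n) · d ∙ ((m / n) * n) · d      ≈⟨ ∙-congˡ (qn·d≈ε (m / n)) ⟩
    (m % n) · d ∙ ε                      ≈⟨ identityʳ _ ⟩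
    (m % n) · d                          ∎

  ≋⇒·d≈ : ∀ i j → i ≋ j → i · d ≈ j · d
  ≋⇒·d≈ i j i≋j = ≈-trans (·d≈%n·d i) (≈-trans (≈-reflexive (cong (_· d) i≋j)) (≈-sym (·d≈%n·d j)))

  ·d-distinct : ∀ {i j} → i < j → j < n → ¬ i · d ≈ j · d
  ·d-distinct {i} {j} i<j j<n eq = ·d≉ε (j ∸ i) (m<n⇒0<n∸m i<j) (≤-<-trans (m∸n≤m j i) j<n)
    (≈-sym (∙-cancelˡ (i · d) ε ((j ∸ i) · d) (begin
      i · d ∙ ε                ≈⟨ identityʳ _ ⟩
      i · d                    ≈⟨ eq ⟩
      j · d                    ≈⟨ ≈-reflexive (cong (_· d) (m+[n∸m]≡n (<⇒≤ i<j))) ⟨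
      (i + (j ∸ i)) · d        ≈⟨ ×-homo-+ d i (j ∸ i) ⟩
      i · d ∙ (j ∸ i) · d      ∎)))

  ·d-injective : ∀ {i j} → i < n → j < n → i · d ≈ j · d → i ≡ j
  ·d-injective {i} {j} i<n j<n eq with <-cmp i j
  ... | tri< i<j _ _ = ⊥-elim (·d-distinct i<j j<n eq)
  ... | tri≈ _ i≡j _ = i≡j
  ... | tri> _ _ j<i = ⊥-elim (·d-distinct j<i i<n (≈-sym eq))

  ·d-injectiveF : ∀ (i j : Fin n) → toℕ i · d ≈ toℕ j · d → i ≡ j
  ·d-injectiveF i j eq = Fin.toℕ-injective (·d-injective (Fin.toℕ<n i) (Fin.toℕ<n j) eq)

  ·d-⁻¹ : ∀ m → (m · d) ⁻¹ ≈ (m * (1 + k)) · d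
  ·d-⁻¹ m = ≈-sym (inverseʳ-unique (m · d) ((m * (1 + k)) · d) (begin
    m · d ∙ (m * (1 + k)) · d  ≈⟨ ×-homo-+ d m (m * (1 + k)) ⟨
    (m + m * (1 + k)) · d      ≈⟨ ≈-reflexive (cong (_· d) (*-suc m (1 + k))) ⟨
    (m * n) · d                ≈⟨ qn·d≈ε m ⟩
    ε                          ∎))

  infix 4 _∼_
  _∼_ : Γ → Γ → Set ℓ
  y ∼ z = ∃ λ m → z ≈ y ∙ m · d

  ∼-refl : ∀ {y} → y ∼ y
  ∼-refl {y} = 0 , ≈-sym (identityʳ y)

  ≈⇒∼ : ∀ {y z} → y ≈ z → y ∼ z
  ≈⇒∼ {y} y≈z = 0 , ≈-trans (≈-sym y≈z) (≈-sym (identityʳ y))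

  ∼-trans : ∀ {x y z} → x ∼ y → y ∼ z → x ∼ z
  ∼-trans {x} {y} {z} (m , y≈) (m′ , z≈) = m + m′ , (begin
    z                    ≈⟨ z≈ ⟩
    y ∙ m′ · d           ≈⟨ ∙-congʳ y≈ ⟩
    (x ∙ m · d) ∙ m′ · d ≈⟨ assoc _ _ _ ⟩
    x ∙ (m · d ∙ m′ · d) ≈⟨ ∙-congˡ (×-homo-+ d m m′) ⟨
    x ∙ (m + m′) · d     ∎)

  ∼-sym : ∀ {x y} → x ∼ y → y ∼ x
  ∼-sym {x} {y} (m , y≈) = m * (1 + k) , (begin
    x                          ≈⟨ identityʳ x ⟨
    x ∙ ε                      ≈⟨ ∙-congˡ (inverseʳ (m · d)) ⟨
    x ∙ (m · d ∙ (m · d) ⁻¹)   ≈⟨ assoc _ _ _ ⟨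
    (x ∙ m · d) ∙ (m · d) ⁻¹   ≈⟨ ∙-cong (≈-sym y≈) (·d-⁻¹ m) ⟩
    y ∙ (m * (1 + k)) · d      ∎)

  ∼-respˡ : ∀ {x x′ y} → x ≈ x′ → x ∼ y → x′ ∼ y
  ∼-respˡ x≈x′ (m , y≈) = m , ≈-trans y≈ (∙-congʳ x≈x′)

  ∼-respʳ : ∀ {x y y′} → y ≈ y′ → x ∼ y → x ∼ y′
  ∼-respʳ y≈y′ (m , y≈) = m , ≈-trans (≈-sym y≈y′) y≈

  ∼-∙ : ∀ {x y x′ y′} → x ∼ y → x′ ∼ y′ → x ∙ x′ ∼ y ∙ y′
  ∼-∙ {x} {y} {x′} {y′} (m , y≈) (m′ , y′≈) = m + m′ , (begin
    y ∙ y′                       ≈⟨ ∙-cong y≈ y′≈ ⟩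
    (x ∙ m · d) ∙ (x′ ∙ m′ · d)  ≈⟨ interchange _ _ _ _ ⟩
    (x ∙ x′) ∙ (m · d ∙ m′ · d)  ≈⟨ ∙-congˡ (×-homo-+ d m m′) ⟨
    (x ∙ x′) ∙ (m + m′) · d      ∎)

  ∼-⁻¹ : ∀ {x y} → x ∼ y → x ⁻¹ ∼ y ⁻¹
  ∼-⁻¹ {x} {y} (m , y≈) = m * (1 + k) , (begin
    y ⁻¹                    ≈⟨ ⁻¹-cong y≈ ⟩
    (x ∙ m · d) ⁻¹          ≈⟨ ⁻¹-∙-comm x (m · d) ⟨
    x ⁻¹ ∙ (m · d) ⁻¹       ≈⟨ ∙-congˡ (·d-⁻¹ m) ⟩
    x ⁻¹ ∙ (m * (1 + k)) · d ∎)

  ∼⇒Fin : ∀ {y z} → y ∼ z → ∃ λ (i : Fin n) → z ≈ y ∙ toℕ i · d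
  ∼⇒Fin (m , z≈) = m mod n , ≈-trans z≈ (∙-congˡ (≋⇒·d≈ m (toℕ (m mod n)) (≡.sym (mod-≋ m))))

  coset : Γ → Fin n → Γ
  coset y i = y ∙ toℕ i · d

  reflect : Γ → Γ → Γ
  reflect w y = w ∙ y ⁻¹

  reflect-cong : ∀ w {x y} → x ≈ y → reflect w x ≈ reflect w y
  reflect-cong w x≈y = ∙-congˡ (⁻¹-cong x≈y)

  reflect-involutive : ∀ w y → reflect w (reflect w y) ≈ y
  reflect-involutive w y = begin
    w ∙ (w ∙ y ⁻¹) ⁻¹      ≈⟨ ∙-congˡ (⁻¹-∙-comm w (y ⁻¹)) ⟨
    w ∙ (w ⁻¹ ∙ y ⁻¹ ⁻¹)   ≈⟨ assoc _ _ _ ⟨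
    (w ∙ w ⁻¹) ∙ y ⁻¹ ⁻¹   ≈⟨ ∙-cong (inverseʳ w) (⁻¹-involutive y) ⟩
    ε ∙ y                  ≈⟨ identityˡ y ⟩
    y                      ∎

  ∼-reflect : ∀ w {x y} → x ∼ y → reflect w x ∼ reflect w y
  ∼-reflect w x∼y = ∼-∙ ∼-refl (∼-⁻¹ x∼y)

  coset-injective : ∀ y i j → coset y i ≈ coset y j → i ≡ j
  coset-injective y i j eq = ·d-injectiveF i j (∙-cancelˡ y _ _ eq)

  coset-overlap : ∀ y z i j → coset y i ≈ coset z j → ∀ i′ → ∃ λ j′ → coset y i′ ≈ coset z j′
  coset-overlap y z i j eq i′ =
    ∼⇒Fin (∼-trans (∼-trans (toℕ j , eq) (∼-sym (toℕ i , ≈-refl))) (toℕ i′ , ≈-refl))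

  NonSquare : Γ → Set (a ⊔ ℓ)
  NonSquare w = ∀ y → ¬ y ∙ y ∼ w

  Paired : Γ → Γ → Γ → Set ℓ
  Paired w y u = y ∼ u ⊎ reflect w y ∼ u

  Paired-respʳ : ∀ w {y u u′} → u ≈ u′ → Paired w y u → Paired w y u′
  Paired-respʳ w u≈u′ (inj₁ y∼u) = inj₁ (∼-respʳ u≈u′ y∼u)
  Paired-respʳ w u≈u′ (inj₂ y∼u) = inj₂ (∼-respʳ u≈u′ y∼u)

  reflect-swap : ∀ w {y u} → reflect w y ∼ u → reflect w u ∼ y
  reflect-swap w {y} y∼u = ∼-sym (∼-respˡ (reflect-involutive w y) (∼-reflect w y∼u))

  Paired-sym : ∀ w {y u} → Paired w y u → Paired w u y
  Paired-sym w (inj₁ y∼u) = inj₁ (∼-sym y∼u)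
  Paired-sym w (inj₂ y∼u) = inj₂ (reflect-swap w y∼u)

  Paired-trans : ∀ w {x y z} → Paired w x y → Paired w y z → Paired w x z
  Paired-trans w (inj₁ x∼y) (inj₁ y∼z) = inj₁ (∼-trans x∼y y∼z)
  Paired-trans w (inj₁ x∼y) (inj₂ y∼z) = inj₂ (∼-trans (∼-reflect w x∼y) y∼z)
  Paired-trans w (inj₂ x∼y) (inj₁ y∼z) = inj₂ (∼-trans x∼y y∼z)
  Paired-trans w (inj₂ x∼y) (inj₂ y∼z) = inj₁ (∼-trans (∼-sym (reflect-swap w x∼y)) y∼z)

  block : Γ → Γ → Fin (n + n) → Γ
  block w y = [ coset y , reflect w ∘ coset y ] ∘ splitAt n

  block-↑ˡ : ∀ w y i → block w y (i ↑ˡ n) ≈ coset y i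
  block-↑ˡ w y i = ≈-reflexive (cong [ coset y , reflect w ∘ coset y ] (Fin.splitAt-↑ˡ n i n))

  block-↑ʳ : ∀ w y i → block w y (n ↑ʳ i) ≈ reflect w (coset y i)
  block-↑ʳ w y i = ≈-reflexive (cong [ coset y , reflect w ∘ coset y ] (Fin.splitAt-↑ʳ n n i))

  block-Paired : ∀ w y l → Paired w y (block w y l)
  block-Paired w y l with splitAt n l
  ... | inj₁ i = inj₁ (toℕ i , ≈-refl)
  ... | inj₂ i = inj₂ (∼-reflect w (toℕ i , ≈-refl))

  Paired⇒∈block : ∀ w y {u} → Paired w y u → ∃ λ l → block w y l ≈ u
  Paired⇒∈block w y (inj₁ y∼u) =
    let i , u≈ = ∼⇒Fin y∼u in i ↑ˡ n , ≈-trans (block-↑ˡ w y i) (≈-sym u≈)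
  Paired⇒∈block w y {u} (inj₂ y∼u) =
    let i , u≈ = ∼⇒Fin (∼-sym (reflect-swap w y∼u)) in
    n ↑ʳ i , ≈-trans (block-↑ʳ w y i) (≈-trans (reflect-cong w (≈-sym u≈)) (reflect-involutive w u))

  block-self : ∀ w y → ∃ λ l → block w y l ≈ y
  block-self w y = Paired⇒∈block w y (inj₁ ∼-refl)

  block-overlap : ∀ w y z l l′ → block w y l ≈ block w z l′ → ∀ i → ∃ λ j → block w y i ≈ block w z j
  block-overlap w y z l l′ eq i =
    let j , eq′ = Paired⇒∈block w z
                    (Paired-trans w (Paired-trans w (Paired-respʳ w (≈-sym eq) (block-Paired w z l′))
                                                    (Paired-sym w (block-Paired w y l)))
                                    (block-Paired w y i))
    in j , ≈-sym eq′

  subgroup-overlap : ∀ y l j → block ε y l ≈ coset ε j → ∀ i → ∃ λ j′ → block ε y i ≈ coset ε j′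
  subgroup-overlap y l j eq i with Paired-trans ε (Paired-trans ε (inj₁ (∼-respʳ (≈-sym eq) (toℕ j , ≈-refl)))
                                                          (Paired-sym ε (block-Paired ε y l)))
                                                (block-Paired ε y i)
  ... | inj₁ ε∼u = let j′ , u≈ = ∼⇒Fin ε∼u in j′ , u≈
  ... | inj₂ ε∼u = let j′ , u≈ = ∼⇒Fin (∼-respˡ (inverseʳ ε) ε∼u) in j′ , u≈

  opposite⇒square : ∀ w y i j → coset y i ≈ reflect w (coset y j) → y ∙ y ∼ w
  opposite⇒square w y i j eq = toℕ i + toℕ j , (begin
    w                                  ≈⟨ identityʳ w ⟨
    w ∙ ε                              ≈⟨ ∙-congˡ (inverseˡ (coset y j)) ⟨
    w ∙ ((coset y j) ⁻¹ ∙ coset y j)   ≈⟨ assoc _ _ _ ⟨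
    reflect w (coset y j) ∙ coset y j  ≈⟨ ∙-congʳ eq ⟨
    coset y i ∙ coset y j              ≈⟨ interchange _ _ _ _ ⟩
    (y ∙ y) ∙ (toℕ i · d ∙ toℕ j · d)  ≈⟨ ∙-congˡ (×-homo-+ d (toℕ i) (toℕ j)) ⟨
    (y ∙ y) ∙ (toℕ i + toℕ j) · d      ∎)

  block-injective : ∀ w y → ¬ y ∙ y ∼ w → ∀ l l′ → block w y l ≈ block w y l′ → l ≡ l′
  block-injective w y non-square l l′ eq =
    ≡.trans (≡.sym (Fin.join-splitAt n n l))
      (≡.trans (cong (join n n) (halves (splitAt n l) (splitAt n l′) eq)) (Fin.join-splitAt n n l′))
    where
    halves : ∀ p q → [ coset y , reflect w ∘ coset y ] p ≈ [ coset y , reflect w ∘ coset y ] q → p ≡ q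
    halves (inj₁ i) (inj₁ j) eq = cong inj₁ (coset-injective y i j eq)
    halves (inj₁ i) (inj₂ j) eq = ⊥-elim (non-square (opposite⇒square w y i j eq))
    halves (inj₂ i) (inj₁ j) eq = ⊥-elim (non-square (opposite⇒square w y j i (≈-sym eq)))
    halves (inj₂ i) (inj₂ j) eq =
      cong inj₂ (coset-injective y i j (⁻¹-injective (∙-cancelˡ w _ _ eq)))

  module Counting (c : ℕ) (Γ-size : HasCardinality G (2 * n * c)) where
    enum : Fin (2 * n * c) → Γ
    enum = proj₁ Γ-size

    open FiniteSetoid setoid (2 * n * c) enum (proj₁ (proj₂ Γ-size)) (proj₂ (proj₂ Γ-size))

    _∼?_ : ∀ y z → Dec (y ∼ z)
    y ∼? z with Fin.any? (λ i → z ≈? coset y i)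
    ... | yes (i , z≈) = yes (toℕ i , z≈)
    ... | no ∉coset = no (∉coset ∘ ∼⇒Fin)

    -- Otherwise Γ would split into ⟨d⟩ and blocks y⟨d⟩ ∪ y⁻¹⟨d⟩ of size 2n, making |Γ|/n odd.
    ∃-order-2-mod-⟨d⟩ : ∃ λ e → ¬ ε ∼ e × ε ∼ e ∙ e
    ∃-order-2-mod-⟨d⟩ with Fin.any? (λ i → ¬? (ε ∼? enum i) ×-dec (ε ∼? (enum i ∙ enum i)))
    ... | yes (i , found) = enum i , found
    ... | no none = ⊥-elim (2nc≢n+m[n+n] n c blocks size)
      where
      halving : ∀ y → ε ∼ y ∙ y → ε ∼ y
      halving y ε∼yy with ε ∼? y
      ... | yes ε∼y = ε∼y
      ... | no ε≁y = ⊥-elim (none (index y , ε≁y ∘ ∼-respʳ (enum-index y) ,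
                                   ∼-respʳ (≈-sym (∙-cong (enum-index y) (enum-index y))) ε∼yy))

      outside-injective : ∀ y → (∀ j → ¬ coset ε j ≈ y) → ∀ l l′ → block ε y l ≈ block ε y l′ → l ≡ l′
      outside-injective y outside = block-injective ε y λ yy∼ε →
        let j , y≈ = ∼⇒Fin (halving y (∼-sym yy∼ε)) in outside j (≈-sym y≈)

      open Partition (coset ε) (block ε)
        (coset-injective ε)
        outside-injective (block-self ε) (block-overlap ε) subgroup-overlap
      open Decomposition decomposition using (blocks; size)

    module Cosets = Partition {0} {n} (λ ()) coset (λ ()) (λ y _ → coset-injective y) (λ y → zero , identityʳ y)
                              coset-overlap (λ _ _ ())
    open Cosets.Decomposition Cosets.decomposition renaming (blocks to m; rep to r)

    cosetIndex : Γ → Fin m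
    cosetIndex g with surjective g
    ... | inj₂ (x , _) , _ = x

    r-cosetIndex : ∀ g → r (cosetIndex g) ∼ g
    r-cosetIndex g with surjective g
    ... | inj₂ (x , i) , g≈ = toℕ i , ≈-sym g≈

    cosetIndex-unique : ∀ g x → r x ∼ g → cosetIndex g ≡ x
    cosetIndex-unique g x rx∼g with surjective g
    ... | inj₂ (x′ , i′) , g≈ = let i , g≈′ = ∼⇒Fin rx∼g in
      cong (λ { (inj₂ (x , _)) → x ; (inj₁ ()) }) (injective (inj₂ (x′ , i′)) (inj₂ (x , i)) (≈-trans g≈ g≈′))

    cosetIndex-cong : ∀ {g g′} → g ∼ g′ → cosetIndex g ≡ cosetIndex g′
    cosetIndex-cong {g} {g′} g∼g′ =
      ≡.sym (cosetIndex-unique g′ (cosetIndex g) (∼-trans (r-cosetIndex g) g∼g′))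

    -- If every coset were a square, doubling would permute the cosets, yet it sends e⟨d⟩ ≠ ⟨d⟩ to ⟨d⟩.
    ∃-non-square : ∃ NonSquare
    ∃-non-square with Fin.any? (λ w → Fin.all? (λ y → ¬? ((enum y ∙ enum y) ∼? enum w)))
    ... | yes (w , non-square) = enum w , λ y yy∼w →
      non-square (index y) (∼-respˡ (∙-cong (≈-sym (enum-index y)) (≈-sym (enum-index y))) yy∼w)
    ... | no ¬∃ = ⊥-elim (e≁ε ε∼e)
      where
      e = proj₁ ∃-order-2-mod-⟨d⟩
      e≁ε = proj₁ (proj₂ ∃-order-2-mod-⟨d⟩)
      ε∼ee = proj₂ (proj₂ ∃-order-2-mod-⟨d⟩)

      square-root : ∀ w → ∃ λ y → y ∙ y ∼ w
      square-root w =
        let y , ¬¬yy∼w = Fin.¬∀⟶∃¬ _ _ (λ y → ¬? ((enum y ∙ enum y) ∼? enum (index w)))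
                                       (λ all → ¬∃ (index w , all))
        in enum y , ∼-respʳ (enum-index w) (decidable-stable (_ ∼? _) ¬¬yy∼w)

      double : Fin m → Fin m
      double x = cosetIndex (r x ∙ r x)

      double-surjective : ∀ x → ∃ λ z → double z ≡ x
      double-surjective x = let y , yy∼rx = square-root (r x) in
        cosetIndex y , cosetIndex-unique _ x (∼-sym (∼-trans (∼-∙ (r-cosetIndex y) (r-cosetIndex y)) yy∼rx))

      double-cosetIndex : ∀ y → ε ∼ y ∙ y → double (cosetIndex y) ≡ cosetIndex ε
      double-cosetIndex y ε∼yy = cosetIndex-cong (∼-trans (∼-∙ (r-cosetIndex y) (r-cosetIndex y)) (∼-sym ε∼yy))

      same-coset : cosetIndex ε ≡ cosetIndex e
      same-coset = surjective⇒injective double double-surjective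
        (≡.trans (double-cosetIndex ε (≈⇒∼ (≈-sym (identityˡ ε)))) (≡.sym (double-cosetIndex e ε∼ee)))

      ε∼e : ε ∼ e
      ε∼e = ∼-trans (∼-sym (r-cosetIndex ε)) (subst (λ x → r x ∼ e) (≡.sym same-coset) (r-cosetIndex e))

module CellSums {a ℓ : Level} (G : AbelianGroup a ℓ) where
  open AbelianGroup G renaming (Carrier to Γ; refl to ≈-refl; trans to ≈-trans)

  Tally : List (Maybe Γ) → Γ → ℕ → Set ℓ
  Tally xs u m = filledSum G xs ≈ u × filledCount G xs ≡ m

  tally-empty : ∀ {m} (h : Fin m → Maybe Γ) → (∀ j → h j ≡ nothing) → Tally (tabulate h) ε 0
  tally-empty {zero} h _ = ≈-refl , refl
  tally-empty {suc m} h none with h zero | none zero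
  ... | nothing | refl = tally-empty (h ∘ suc) (none ∘ suc)

  tally-single : ∀ {m} (h : Fin m → Maybe Γ) j {u} → h j ≡ just u →
                 (∀ j′ → j′ ≢ j → h j′ ≡ nothing) → Tally (tabulate h) u 1
  tally-single {suc m} h zero {u} hj others with h zero | hj
  ... | just _ | refl =
    let s , c = tally-empty (h ∘ suc) (λ j → others (suc j) (λ ())) in
    ≈-trans (∙-congˡ s) (identityʳ u) , cong suc c
  tally-single {suc m} h (suc j) hj others with h zero | others zero (λ ())
  ... | nothing | refl =
    tally-single (h ∘ suc) j hj (λ j′ j′≢j → others (suc j′) (j′≢j ∘ Fin.suc-injective))

  tally-pair : ∀ {m} (h : Fin m → Maybe Γ) j₁ j₂ {u v} → j₁ ≢ j₂ → h j₁ ≡ just u → h j₂ ≡ just v →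
               (∀ j → j ≢ j₁ → j ≢ j₂ → h j ≡ nothing) → Tally (tabulate h) (u ∙ v) 2
  tally-pair {suc m} h zero zero j₁≢j₂ _ _ _ = ⊥-elim (j₁≢j₂ refl)
  tally-pair {suc m} h zero (suc j₂) _ hj₁ hj₂ others with h zero | hj₁
  ... | just _ | refl =
    let s , c = tally-single (h ∘ suc) j₂ hj₂
                  (λ j j≢j₂ → others (suc j) (λ ()) (j≢j₂ ∘ Fin.suc-injective)) in
    ∙-congˡ s , cong suc c
  tally-pair {suc m} h (suc j₁) zero {u} {v} _ hj₁ hj₂ others with h zero | hj₂
  ... | just _ | refl =
    let s , c = tally-single (h ∘ suc) j₁ hj₁
                  (λ j j≢j₁ → others (suc j) (j≢j₁ ∘ Fin.suc-injective) (λ ())) in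
    ≈-trans (∙-congˡ s) (comm v u) , cong suc c
  tally-pair {suc m} h (suc j₁) (suc j₂) j₁≢j₂ hj₁ hj₂ others with h zero | others zero (λ ()) (λ ())
  ... | nothing | refl =
    tally-pair (h ∘ suc) j₁ j₂ (j₁≢j₂ ∘ cong suc) hj₁ hj₂
      (λ j j≢j₁ j≢j₂ → others (suc j) (j≢j₁ ∘ Fin.suc-injective) (j≢j₂ ∘ Fin.suc-injective))

  tally-two-cells : ∀ {m} (h : Fin m → Maybe Γ) j₁ j₂ {u v} → j₁ ≢ j₂ → h j₁ ≡ just u → h j₂ ≡ just v →
                    (∀ j → j ≢ j₁ → j ≢ j₂ → h j ≡ nothing) → Tally (map h (allFin m)) (u ∙ v) 2
  tally-two-cells h j₁ j₂ j₁≢j₂ hj₁ hj₂ others =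
    subst (λ xs → Tally xs _ 2) (≡.sym (List.map-tabulate id h)) (tally-pair h j₁ j₂ j₁≢j₂ hj₁ hj₂ others)

module TwoDiagonal {a ℓ : Level} (G : AbelianGroup a ℓ) (k : ℕ) where
  open AbelianGroup G using (_∙_) renaming (Carrier to Γ)
  open Residues k
  open CellSums G

  InDiagonals⇔≋ : ∀ {m} (t i j : Fin n) → InDiagonals G m t i j ⇔ ∃ λ r → r < m × toℕ i + toℕ t + r ≋ toℕ j
  InDiagonals⇔≋ t i j = mk⇔
    (λ (r , r<m , q , eq) → r , r<m , ≡.sym (≡+qn⇒≋ _ (toℕ j) q eq))
    (λ (r , r<m , ≋j) → r , r<m , ≋⇒≡+qn _ j (≡.sym ≋j))

  twoDiagonal : (Fin n → Γ) → (Fin n → Γ) → Array G n n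
  twoDiagonal α β i j with j Fin.≟ i | j Fin.≟ next i
  ... | yes _ | _     = just (α i)
  ... | no _  | yes _ = just (β i)
  ... | no _  | no _  = nothing

  module _ (α β : Fin n → Γ) where

    twoDiagonal-diag : ∀ i → twoDiagonal α β i i ≡ just (α i)
    twoDiagonal-diag i with i Fin.≟ i
    ... | yes _ = refl
    ... | no i≢i = ⊥-elim (i≢i refl)

    twoDiagonal-next : ∀ i → twoDiagonal α β i (next i) ≡ just (β i)
    twoDiagonal-next i with next i Fin.≟ i | next i Fin.≟ next i
    ... | yes next≡i | _ = ⊥-elim (≢next i (≡.sym next≡i))
    ... | no _ | yes _ = refl
    ... | no _ | no ≢ = ⊥-elim (≢ refl)

    twoDiagonal-off : ∀ i j → j ≢ i → j ≢ next i → twoDiagonal α β i j ≡ nothing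
    twoDiagonal-off i j j≢i j≢next with j Fin.≟ i | j Fin.≟ next i
    ... | yes j≡i | _ = ⊥-elim (j≢i j≡i)
    ... | no _ | yes j≡next = ⊥-elim (j≢next j≡next)
    ... | no _ | no _ = refl

    twoDiagonal-cases : ∀ i j {h} → twoDiagonal α β i j ≡ just h → (j ≡ i × h ≡ α i) ⊎ (j ≡ next i × h ≡ β i)
    twoDiagonal-cases i j eq with j Fin.≟ i | j Fin.≟ next i | eq
    ... | yes j≡i | _ | refl = inj₁ (j≡i , refl)
    ... | no _ | yes j≡next | refl = inj₂ (j≡next , refl)

    twoDiagonal-row : ∀ i → Tally (row G (twoDiagonal α β) i) (α i ∙ β i) 2
    twoDiagonal-row i = tally-two-cells (twoDiagonal α β i) i (next i) (≢next i)
      (twoDiagonal-diag i) (twoDiagonal-next i) (twoDiagonal-off i)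

    twoDiagonal-col : ∀ j → Tally (col G (twoDiagonal α β) j) (α j ∙ β (prev j)) 2
    twoDiagonal-col j = tally-two-cells (λ i → twoDiagonal α β i j) j (prev j) j≢prev
      (twoDiagonal-diag j)
      (subst (λ j′ → twoDiagonal α β (prev j) j′ ≡ just (β (prev j))) (next-prev j) (twoDiagonal-next (prev j)))
      (λ i i≢j i≢prev → twoDiagonal-off i j (i≢j ∘ ≡.sym)
         (λ j≡next → i≢prev (next-injective i (prev j) (≡.trans (≡.sym j≡next) (≡.sym (next-prev j))))))
      where
      j≢prev : j ≢ prev j
      j≢prev j≡prev = ≢next j (≡.sym (≡.trans (cong next j≡prev) (next-prev j)))

    twoDiagonal-shape : ∀ i j → Filled G (twoDiagonal α β i j) ⇔ InDiagonals G 2 zero i j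
    twoDiagonal-shape i j =
      mk⇔ (Equivalence.from (InDiagonals⇔≋ zero i j) ∘ to) (from ∘ Equivalence.to (InDiagonals⇔≋ zero i j))
      where
      i+0+0≡i : toℕ i + 0 + 0 ≡ toℕ i
      i+0+0≡i = ≡.trans (+-identityʳ _) (+-identityʳ _)

      i+0+1≡1+i : toℕ i + 0 + 1 ≡ 1 + toℕ i
      i+0+1≡1+i = ≡.trans (cong (_+ 1) (+-identityʳ _)) (+-comm _ 1)

      to : Filled G (twoDiagonal α β i j) → ∃ λ r → r < 2 × toℕ i + 0 + r ≋ toℕ j
      to (h , eq) with twoDiagonal-cases i j eq
      ... | inj₁ (refl , _) = 0 , s≤s z≤n , ≡⇒≋ i+0+0≡i
      ... | inj₂ (refl , _) = 1 , s≤s (s≤s z≤n) , ≡.trans (≡⇒≋ i+0+1≡1+i) (≡.sym (mod-≋ (1 + toℕ i)))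

      from : (∃ λ r → r < 2 × toℕ i + 0 + r ≋ toℕ j) → Filled G (twoDiagonal α β i j)
      from (0 , _ , ≋j) with toℕ-≋-injective i j (≡.trans (≡⇒≋ (≡.sym i+0+0≡i)) ≋j)
      ... | refl = α i , twoDiagonal-diag i
      from (1 , _ , ≋j)
        with toℕ-≋-injective (next i) j (≡.trans (mod-≋ (1 + toℕ i)) (≡.trans (≡⇒≋ (≡.sym i+0+1≡1+i)) ≋j))
      ... | refl = β i , twoDiagonal-next i
      from (suc (suc _) , s≤s (s≤s ()) , _)

module Construction {a ℓ : Level} (G : AbelianGroup a ℓ) (k c : ℕ) (d : AbelianGroup.Carrier G)
    (d-order : HasOrder G d (2 + k)) (Γ-size : HasCardinality G (2 * (2 + k) * c)) where
  open AbelianGroup G hiding (refl) renaming (Carrier to Γ; sym to ≈-sym; trans to ≈-trans; reflexive to ≈-reflexive)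
  open import Relation.Binary.Reasoning.Setoid setoid
  open Residues k
  open Multiples G
  open Cyclic G k d d-order
  open Counting c Γ-size using (enum)
  open TwoDiagonal G k
  open FiniteSetoid setoid (2 * n * c) enum (proj₁ (proj₂ Γ-size)) (proj₂ (proj₂ Γ-size))

  module _ (ω : Γ) (ω-non-square : NonSquare ω) where

    module Blocks = Partition {0} {n + n} (λ ()) (block ω) (λ ())
                      (λ y _ → block-injective ω y (ω-non-square y)) (block-self ω) (block-overlap ω) (λ _ _ ())
    open Blocks.Decomposition Blocks.decomposition renaming (blocks to K; rep to r)

    α : Fin K → Fin n → Γ
    α x = coset (r x)

    β : Fin K → Fin n → Γ
    β x = reflect ω ∘ coset (r x)

    arrays : Fin K → Array G n n
    arrays x = twoDiagonal (α x) (β x)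

    row-sum : ∀ x i → α x i ∙ β x i ≈ ω
    row-sum x i = begin
      α x i ∙ (ω ∙ α x i ⁻¹)   ≈⟨ comm _ _ ⟩
      (ω ∙ α x i ⁻¹) ∙ α x i   ≈⟨ assoc _ _ _ ⟩
      ω ∙ (α x i ⁻¹ ∙ α x i)   ≈⟨ ∙-congˡ (inverseˡ _) ⟩
      ω ∙ ε                    ≈⟨ identityʳ ω ⟩
      ω                        ∎

    α-next : ∀ x i → α x (next i) ≈ α x i ∙ d
    α-next x i = begin
      r x ∙ toℕ (next i) · d      ≈⟨ ∙-congˡ (≋⇒·d≈ (toℕ (next i)) (1 + toℕ i) (mod-≋ (1 + toℕ i))) ⟩
      r x ∙ (d ∙ toℕ i · d)       ≈⟨ ∙-congˡ (comm _ _) ⟩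
      r x ∙ (toℕ i · d ∙ d)       ≈⟨ assoc _ _ _ ⟨
      α x i ∙ d                   ∎

    col-sum : ∀ x j → α x j ∙ β x (prev j) ≈ ω ∙ d
    col-sum x j = begin
      α x j ∙ β x (prev j)          ≈⟨ ∙-congʳ (≈-trans (≈-reflexive (cong (α x) (≡.sym (next-prev j))))
                                                          (α-next x (prev j))) ⟩
      (y ∙ d) ∙ β x (prev j)        ≈⟨ ∙-congʳ (comm y d) ⟩
      (d ∙ y) ∙ β x (prev j)        ≈⟨ assoc _ _ _ ⟩
      d ∙ (y ∙ β x (prev j))        ≈⟨ ∙-congˡ (row-sum x (prev j)) ⟩
      d ∙ ω                         ≈⟨ comm d ω ⟩
      ω ∙ d                         ∎
      where y = α x (prev j)

    cell : Fin n ⊎ Fin n → Fin n × Fin n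
    cell (inj₁ i) = i , i
    cell (inj₂ i) = i , next i

    location : Fin K × Fin (n + n) → Fin K × Fin n × Fin n
    location (x , l) = x , cell (splitAt n l)

    cell-entry : ∀ x p → arrays x (proj₁ (cell p)) (proj₂ (cell p)) ≡ just ([ α x , β x ] p)
    cell-entry x (inj₁ i) = twoDiagonal-diag (α x) (β x) i
    cell-entry x (inj₂ i) = twoDiagonal-next (α x) (β x) i

    entry⇒location : ∀ x i j {h} → arrays x i j ≡ just h → ∃ λ l → (x , i , j) ≡ location (x , l) × h ≈ block ω (r x) l
    entry⇒location x i j entry with twoDiagonal-cases (α x) (β x) i j entry
    ... | inj₁ (refl , refl) = i ↑ˡ n , cong (λ p → x , cell p) (≡.sym (Fin.splitAt-↑ˡ n i n)) , ≈-sym (block-↑ˡ ω (r x) i)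
    ... | inj₂ (refl , refl) = n ↑ʳ i , cong (λ p → x , cell p) (≡.sym (Fin.splitAt-↑ʳ n n i)) , ≈-sym (block-↑ʳ ω (r x) i)

    exactlyOnce : ∀ g → Σ (Fin K × Fin n × Fin n) λ p →
                    Contains G arrays p g × (∀ p′ → Contains G arrays p′ g → p′ ≡ p)
    exactlyOnce g with surjective g
    ... | inj₂ (x , l) , g≈ = location (x , l) , (block ω (r x) l , cell-entry x (splitAt n l) , g≈) , unique
      where
      unique : ∀ p′ → Contains G arrays p′ g → p′ ≡ location (x , l)
      unique (x′ , i′ , j′) (h , entry , h≈g) =
        let l′ , p′≡ , h≈ = entry⇒location x′ i′ j′ entry in
        ≡.trans p′≡ (cong location (inj₂-injective
          (injective (inj₂ (x′ , l′)) (inj₂ (x , l)) (≈-trans (≈-sym h≈) (≈-trans h≈g (≈-sym g≈))))))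

    K≡c : K ≡ c
    K≡c = *-cancelʳ-≡ K c (n + n) (≡.trans (≡.sym size) (solve 2 (λ n c → con 2 :* n :* c := c :* (n :+ n)) refl n c))
      where open +-*-Solver

    isMRS : IsMRS G n n 2 2 K arrays
    isMRS = record
      { order = subst (HasCardinality G) (≡.trans (solve 2 (λ n c → con 2 :* n :* c := n :* con 2 :* c) refl n c)
                                                  (cong (n * 2 *_) (≡.sym K≡c))) Γ-size
      ; exactlyOnce = exactlyOnce
      ; rowFilled = λ x i → proj₂ (twoDiagonal-row (α x) (β x) i)
      ; colFilled = λ x j → proj₂ (twoDiagonal-col (α x) (β x) j)
      ; magicSums = ω , ω ∙ d
                  , (λ x i → ≈-trans (proj₁ (twoDiagonal-row (α x) (β x) i)) (row-sum x i))
                  , (λ x j → ≈-trans (proj₁ (twoDiagonal-col (α x) (β x) j)) (col-sum x j))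
      }
      where open +-*-Solver

    diagonalMRS : DiagonalMRSExists G n 2 c
    diagonalMRS = subst (DiagonalMRSExists G n 2) K≡c (arrays , isMRS , λ x → zero , twoDiagonal-shape (α x) (β x))

module Necessity {a ℓ : Level} (G : AbelianGroup a ℓ) (k : ℕ) where
  open AbelianGroup G hiding (refl) renaming (Carrier to Γ; sym to ≈-sym; trans to ≈-trans; reflexive to ≈-reflexive)
  open import Algebra.Properties.Group group using (∙-cancelʳ; x≈z//y)
  open import Algebra.Properties.CommutativeSemigroup commutativeSemigroup using (x∙yz≈zx∙y; xy∙z≈xz∙y)
  open import Algebra.Properties.CommutativeSemigroup +-commutativeSemigroup
    using () renaming (xy∙z≈xz∙y to x+y+z≡x+z+y)
  open import Relation.Binary.Reasoning.Setoid setoid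
  open Residues k
  open Multiples G
  open TwoDiagonal G k
  open CellSums G

  module _ (A : Array G n n) (t : Fin n) (shape : ∀ i j → Filled G (A i j) ⇔ InDiagonals G 2 t i j)
      (ω δ : Γ) (row-sum : ∀ i → filledSum G (row G A i) ≈ ω) (col-sum : ∀ j → filledSum G (col G A j) ≈ δ)
      (rows-distinct : ∀ i j i′ j′ {g g′} → A i j ≡ just g → A i′ j′ ≡ just g′ → g ≈ g′ → i ≡ i′) where

    T : ℕ
    T = toℕ t

    rowAt : ℕ → Fin n
    rowAt a = a mod n

    colAt : ℕ → ℕ → Fin n
    colAt r a = (a + T + r) mod n

    rowAt-≋ : ∀ a r → toℕ (rowAt a) + T + r ≋ a + T + r
    rowAt-≋ a r = +-cong-≋ {toℕ (rowAt a) + T} {a + T} {r} (+-cong-≋ {toℕ (rowAt a)} {a} {T} (mod-≋ a) refl) refl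

    filled-on-diagonal : ∀ a r → r < 2 → Filled G (A (rowAt a) (colAt r a))
    filled-on-diagonal a r r<2 = Equivalence.from (shape _ _) (Equivalence.from (InDiagonals⇔≋ t _ _)
      (r , r<2 , ≡.trans (rowAt-≋ a r) (≡.sym (mod-≋ (a + T + r)))))

    filled⇒on-diagonal : ∀ i j {h} → A i j ≡ just h → ∃ λ r → r < 2 × toℕ i + T + r ≋ toℕ j
    filled⇒on-diagonal i j {h} entry = Equivalence.to (InDiagonals⇔≋ t i j) (Equivalence.to (shape i j) (h , entry))

    unfilled : ∀ (x : Maybe Γ) → (∀ h → x ≢ just h) → x ≡ nothing
    unfilled (just h) ≢just = ⊥-elim (≢just h refl)
    unfilled nothing _ = refl

    α : ℕ → Γ
    α a = proj₁ (filled-on-diagonal a 0 (s≤s z≤n))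

    α-entry : ∀ a → A (rowAt a) (colAt 0 a) ≡ just (α a)
    α-entry a = proj₂ (filled-on-diagonal a 0 (s≤s z≤n))

    β : ℕ → Γ
    β a = proj₁ (filled-on-diagonal a 1 (s≤s (s≤s z≤n)))

    β-entry : ∀ a → A (rowAt a) (colAt 1 a) ≡ just (β a)
    β-entry a = proj₂ (filled-on-diagonal a 1 (s≤s (s≤s z≤n)))

    colAt-0≢1 : ∀ a → colAt 0 a ≢ colAt 1 a
    colAt-0≢1 a eq = mod≢mod-suc (a + T + 0)
      (≡.trans eq (cong (_mod n) (≡.trans (+-comm (a + T) 1) (cong suc (≡.sym (+-identityʳ (a + T)))))))

    row-support : ∀ a j → j ≢ colAt 0 a → j ≢ colAt 1 a → A (rowAt a) j ≡ nothing
    row-support a j j≢0 j≢1 = unfilled _ λ h entry → off-diagonal (filled⇒on-diagonal (rowAt a) j entry)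
      where
      off-diagonal : ¬ ∃ λ r → r < 2 × toℕ (rowAt a) + T + r ≋ toℕ j
      off-diagonal (0 , _ , ≋j) = j≢0 (≋⇒≡-mod j (a + T + 0) (≡.trans (≡.sym ≋j) (rowAt-≋ a 0)))
      off-diagonal (1 , _ , ≋j) = j≢1 (≋⇒≡-mod j (a + T + 1) (≡.trans (≡.sym ≋j) (rowAt-≋ a 1)))
      off-diagonal (suc (suc _) , s≤s (s≤s ()) , _)

    colAt-0-suc : ∀ a → colAt 0 (1 + a) ≡ colAt 1 a
    colAt-0-suc a = cong (_mod n) (≡.trans (+-identityʳ (1 + a + T)) (≡.sym (+-comm (a + T) 1)))

    cancel-T : ∀ x r y s → x + T + r ≋ y + T + s → x + r ≋ y + s
    cancel-T x r y s eq = +-cancelʳ-≋ (x + r) (y + s) T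
      (≡.trans (≡⇒≋ (x+y+z≡x+z+y x r T)) (≡.trans eq (≡⇒≋ (x+y+z≡x+z+y y T s))))

    col-support : ∀ a i → i ≢ rowAt a → i ≢ rowAt (1 + a) → A i (colAt 1 a) ≡ nothing
    col-support a i i≢a i≢1+a = unfilled _ λ h entry → off-diagonal (filled⇒on-diagonal i (colAt 1 a) entry)
      where
      on-col : ∀ r → toℕ i + T + r ≋ toℕ (colAt 1 a) → toℕ i + r ≋ a + 1
      on-col r ≋col = cancel-T (toℕ i) r a 1 (≡.trans ≋col (mod-≋ (a + T + 1)))
      off-diagonal : ¬ ∃ λ r → r < 2 × toℕ i + T + r ≋ toℕ (colAt 1 a)
      off-diagonal (0 , _ , ≋col) = i≢1+a (≋⇒≡-mod i (1 + a)
        (≡.trans (≡⇒≋ (≡.sym (+-identityʳ (toℕ i)))) (≡.trans (on-col 0 ≋col) (≡⇒≋ (+-comm a 1)))))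
      off-diagonal (1 , _ , ≋col) = i≢a (≋⇒≡-mod i a
        (+-cancelʳ-≋ (toℕ i) a 1 (on-col 1 ≋col)))
      off-diagonal (suc (suc _) , s≤s (s≤s ()) , _)

    row-eq : ∀ a → α a ∙ β a ≈ ω
    row-eq a = ≈-trans (≈-sym (proj₁ (tally-two-cells (A (rowAt a)) (colAt 0 a) (colAt 1 a) (colAt-0≢1 a)
                                        (α-entry a) (β-entry a) (row-support a))))
                       (row-sum (rowAt a))

    col-eq : ∀ a → β a ∙ α (1 + a) ≈ δ
    col-eq a = ≈-trans (≈-sym (proj₁ (tally-two-cells (λ i → A i (colAt 1 a)) (rowAt a) (rowAt (1 + a)) (mod≢mod-suc a)
                                        (β-entry a)
                                        (subst (λ j → A (rowAt (1 + a)) j ≡ just (α (1 + a))) (colAt-0-suc a) (α-entry (1 + a)))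
                                        (col-support a))))
                       (col-sum (colAt 1 a))

    D : Γ
    D = δ ∙ ω ⁻¹

    α-step : ∀ a → α (1 + a) ≈ D ∙ α a
    α-step a = ≈-trans (x≈z//y z ω (δ ∙ x) (begin
      z ∙ ω        ≈⟨ ∙-congˡ (row-eq a) ⟨
      z ∙ (x ∙ y)  ≈⟨ x∙yz≈zx∙y z x y ⟩
      (y ∙ z) ∙ x  ≈⟨ ∙-congʳ (col-eq a) ⟩
      δ ∙ x        ∎)) (xy∙z≈xz∙y δ x (ω ⁻¹))
      where x = α a ; y = β a ; z = α (1 + a)

    α-closed : ∀ a → α a ≈ a · D ∙ α 0
    α-closed zero = ≈-sym (identityˡ _)
    α-closed (suc a) = ≈-trans (α-step a) (≈-trans (∙-congˡ (α-closed a)) (≈-sym (assoc _ _ _)))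

    α-periodic : α n ≡ α 0
    α-periodic = just-injective (≡.trans (≡.sym (α-entry n)) (≡.trans (cong₂ A same-row same-col) (α-entry 0)))
      where
      same-row : rowAt n ≡ rowAt 0
      same-row = mod-cong n 0 (n%n≡0 n)
      same-col : colAt 0 n ≡ colAt 0 0
      same-col = mod-cong (n + T + 0) (T + 0)
        (≡.trans (≡⇒≋ (≡.trans (+-assoc n T 0) (+-comm n (T + 0)))) ([m+n]%n≡m%n (T + 0) n))

    n·D≈ε : n · D ≈ ε
    n·D≈ε = ∙-cancelʳ (α 0) (n · D) ε
      (≈-trans (≈-sym (α-closed n)) (≈-trans (≈-reflexive α-periodic) (≈-sym (identityˡ _))))

    m·D≉ε : ∀ m → 1 ≤ m → m < n → ¬ m · D ≈ ε
    m·D≉ε m 1≤m m<n m·D≈ε = 1+n≰n (≤-trans 1≤m (≤-reflexive m≡0))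
      where
      αm≈α0 : α m ≈ α 0
      αm≈α0 = ≈-trans (α-closed m) (≈-trans (∙-congʳ m·D≈ε) (identityˡ _))
      m≡0 : m ≡ 0
      m≡0 = ≡.trans (≡.sym (m<n⇒m%n≡m m<n)) (≡.trans (≡.sym (toℕ-mod m))
              (cong toℕ (rows-distinct _ _ _ _ (α-entry m) (α-entry 0) αm≈α0)))

    D-order : HasOrder G D n
    D-order = s≤s z≤n , ≈-trans (≈-reflexive (mul≡· n D)) n·D≈ε ,
              λ m 1≤m m<n → m·D≉ε m 1≤m m<n ∘ ≈-trans (≈-reflexive (≡.sym (mul≡· m D)))

IsMRS-entries-distinct : ∀ {a ℓ} (G : AbelianGroup a ℓ) {m n s k c A} → IsMRS G m n s k c A →
                         ∀ x i j x′ i′ j′ {g g′} → A x i j ≡ just g → A x′ i′ j′ ≡ just g′ →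
                         AbelianGroup._≈_ G g g′ → (x , i , j) ≡ (x′ , i′ , j′)
IsMRS-entries-distinct G mrs x i j x′ i′ j′ {g} {g′} entry entry′ g≈g′ =
  let _ , _ , unique = IsMRS.exactlyOnce mrs g′ in
  ≡.trans (unique _ (g , entry , g≈g′)) (≡.sym (unique _ (g′ , entry′ , AbelianGroup.refl G)))

theorem5p5 : ∀ {a ℓ : Level} (G : AbelianGroup a ℓ) (n c : ℕ) →
    2 ≤ n → 1 ≤ c → HasCardinality G (2 * n * c) →
    (DiagonalMRSExists G n 2 c ⇔ ∃ λ g → HasOrder G g n)
theorem5p5 G (suc (suc k)) (suc c′) (s≤s (s≤s z≤n)) (s≤s z≤n) Γ-size = mk⇔ necessity sufficiency
  where
  necessity : DiagonalMRSExists G (2 + k) 2 (suc c′) → ∃ λ g → HasOrder G g (2 + k)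
  necessity (A , mrs , diagonal) =
    let ω , δ , rows , cols = IsMRS.magicSums mrs
        t , shape = diagonal zero
    in _ , Necessity.D-order G k (A zero) t shape ω δ (rows zero) (cols zero)
             (λ i j i′ j′ entry entry′ g≈g′ →
                cong (proj₁ ∘ proj₂) (IsMRS-entries-distinct G mrs zero i j zero i′ j′ entry entry′ g≈g′))

  sufficiency : (∃ λ g → HasOrder G g (2 + k)) → DiagonalMRSExists G (2 + k) 2 (suc c′)
  sufficiency (d , d-order) =
    let ω , ω-non-square = Cyclic.Counting.∃-non-square G k d d-order (suc c′) Γ-size
    in Construction.diagonalMRS G k (suc c′) d d-order Γ-size ω ω-non-square
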